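{- Let $q,n\in\mathbb{N}$ and let $M$ be an $n\times n$ integer matrix satisfying $M\mathbf{1}_n=M^T\mathbf{1}_n$, where $\mathbf{1}_n$ is the all-one vector of length $n$. Then there exists a $q$-dimensional $M$-crystal, i.e., a function $C:[n]^q\to\mathbb{Z}$ such that for every pair $1\le i_1<i_2\le q$ and all $a,b\in[n]$, $$\sum_{\mathbf{c}\in[n]^q,\ c_{i_1}=a,\ c_{i_2}=b} C(\mathbf{c}) = M_{a,b}.$$
   Context: $[n]=\{1,\dots,n\}$; tuples $\mathbf{c}=(c_1,\dots,c_q)\in[n]^q$. (In the paper's notation, a $q$-dimensional $M$-crystal is $C\in\mathcal{T}^{n\cdot\mathbf{1}_q}(\mathbb{Z})$ with $\Pi^{n\cdot\mathbf 1_q}_{\mathbf{i}}\ast C=M$ for every increasing pair $\mathbf{i}=(i_1,i_2)\in[q]^2$, which is exactly the displayed marginal condition.) -}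

module Defs where

open import Data.Nat using (ℕ; zero; suc)
open import Data.Fin using (Fin; zero; suc; _<_; _≟_)
open import Data.Integer using (ℤ; _+_; 0ℤ)
open import Relation.Nullary using (yes; no)
open import Relation.Binary.PropositionalEquality using (_≡_)

sumFin : ∀ {n} → (Fin n → ℤ) → ℤ
sumFin {zero}  f = 0ℤ
sumFin {suc n} f = f zero + sumFin (λ i → f (suc i))

Tuple : ℕ → ℕ → Set
Tuple q n = Fin q → Fin n

_◂_ : ∀ {q n} → Fin n → Tuple q n → Tuple (suc q) n
(a ◂ c) zero    = a
(a ◂ c) (suc i) = c i

sumTuples : ∀ {q n} → (Tuple q n → ℤ) → ℤ
sumTuples {zero}  f = f (λ ())
sumTuples {suc q} f = sumFin (λ a → sumTuples (λ c → f (a ◂ c)))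

restrict : ∀ {q n} → Fin q → Fin q → Fin n → Fin n → (Tuple q n → ℤ) → Tuple q n → ℤ
restrict i₁ i₂ a b C c with c i₁ ≟ a | c i₂ ≟ b
... | yes _ | yes _ = C c
... | _     | _     = 0ℤ

marginal : ∀ {q n} → (Tuple q n → ℤ) → Fin q → Fin q → Fin n → Fin n → ℤ
marginal C i₁ i₂ a b = sumTuples (restrict i₁ i₂ a b C)

Matrix : ℕ → Set
Matrix n = Fin n → Fin n → ℤ

RowColBalanced : ∀ {n} → Matrix n → Set
RowColBalanced {n} M = ∀ (a : Fin n) → sumFin (λ b → M a b) ≡ sumFin (λ b → M b a)

IsCrystal : ∀ q {n} → Matrix n → (Tuple q n → ℤ) → Set
IsCrystal q {n} M C =
  ∀ (i₁ i₂ : Fin q) → i₁ < i₂ → ∀ (a b : Fin n) → marginal C i₁ i₂ a b ≡ M a b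

{-# OPTIONS --safe #-}
-- Let R be the vector of row sums of M. Because M𝟏 = Mᵀ𝟏, the matrix N = M − diag R has
-- vanishing row and column sums. Crystals C with first one-dimensional marginal R are built
-- by induction on the dimension, starting from C(c₀) = R(c₀) and passing from C to
--   C′(c₀, c₁, …) = δ(c₀, c₁) · C(c₁, …) + N(c₀, c₁) · [c₂ = ⋯ = e],
-- for an arbitrary fixed e ∈ [n]. Duplicating the head coordinate gives marginal diag R on the
-- new pair (0, 1) and copies the marginals of C on all other pairs; the second summand adds N
-- on (0, 1) and nothing elsewhere, since summing out c₀ or c₁ kills it.
module Submission where

open import Defs
open import Data.Nat using (ℕ; zero; suc; s≤s; z≤n)
open import Data.Integer using (ℤ; _+_; _*_; -_; _-_; 0ℤ; 1ℤ; -1ℤ)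
open import Data.Integer.Properties hiding (_≟_)
open import Data.Integer.Tactic.RingSolver using (solve-∀)
open import Data.Product using (Σ; _,_)
open import Data.Fin using (Fin; zero; suc; _≟_; _<_)
open import Data.Vec.Functional using (tail)
open import Relation.Nullary using (yes; no; ¬_; contradiction)
open import Relation.Binary.PropositionalEquality
open ≡-Reasoning
open import Algebra.Properties.Semiring.Sum +-*-semiring
  using (sum; sum-cong-≗; sum-replicate-zero; ∑-distrib-+; ∑-comm; *-distribˡ-sum; *-distribʳ-sum)
open import Algebra.Properties.CommutativeSemigroup *-commutativeSemigroup using (x∙yz≈y∙xz)

δ : ∀ {n} → Fin n → Fin n → ℤ
δ zero    zero    = 1ℤ
δ zero    (suc _) = 0ℤ
δ (suc _) zero    = 0ℤ
δ (suc x) (suc y) = δ x y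

δ-sym : ∀ {n} (x y : Fin n) → δ x y ≡ δ y x
δ-sym zero    zero    = refl
δ-sym zero    (suc _) = refl
δ-sym (suc _) zero    = refl
δ-sym (suc x) (suc y) = δ-sym x y

δ-≡ : ∀ {n} {x y : Fin n} → x ≡ y → δ x y ≡ 1ℤ
δ-≡ {x = zero}  refl = refl
δ-≡ {x = suc x} refl = δ-≡ {x = x} refl

δ-≢ : ∀ {n} {x y : Fin n} → ¬ x ≡ y → δ x y ≡ 0ℤ
δ-≢ {x = zero}  {zero}  x≢y = contradiction refl x≢y
δ-≢ {x = zero}  {suc _} _   = refl
δ-≢ {x = suc _} {zero}  _   = refl
δ-≢ {x = suc x} {suc y} x≢y = δ-≢ (λ x≡y → x≢y (cong suc x≡y))

sumFin≡sum : ∀ {n} (f : Fin n → ℤ) → sumFin f ≡ sum f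
sumFin≡sum {zero}  f = refl
sumFin≡sum {suc n} f = cong (f zero +_) (sumFin≡sum (λ i → f (suc i)))

module _ {n : ℕ} where

  sumFin-cong : {f g : Fin n → ℤ} → (∀ i → f i ≡ g i) → sumFin f ≡ sumFin g
  sumFin-cong {f} {g} f≗g = begin
    sumFin f ≡⟨ sumFin≡sum f ⟩
    sum f    ≡⟨ sum-cong-≗ f≗g ⟩
    sum g    ≡⟨ sumFin≡sum g ⟨
    sumFin g ∎

  sumFin-zero : sumFin {n} (λ _ → 0ℤ) ≡ 0ℤ
  sumFin-zero = trans (sumFin≡sum {n} (λ _ → 0ℤ)) (sum-replicate-zero n)

  sumFin-distrib-+ : (f g : Fin n → ℤ) → sumFin (λ i → f i + g i) ≡ sumFin f + sumFin g
  sumFin-distrib-+ f g = begin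
    sumFin (λ i → f i + g i) ≡⟨ sumFin≡sum (λ i → f i + g i) ⟩
    sum (λ i → f i + g i)    ≡⟨ ∑-distrib-+ f g ⟩
    sum f + sum g            ≡⟨ cong₂ _+_ (sumFin≡sum f) (sumFin≡sum g) ⟨
    sumFin f + sumFin g      ∎

  sumFin-*ˡ : (k : ℤ) (f : Fin n → ℤ) → sumFin (λ i → k * f i) ≡ k * sumFin f
  sumFin-*ˡ k f = begin
    sumFin (λ i → k * f i) ≡⟨ sumFin≡sum (λ i → k * f i) ⟩
    sum (λ i → k * f i)    ≡⟨ *-distribˡ-sum k f ⟨
    k * sum f              ≡⟨ cong (k *_) (sumFin≡sum f) ⟨
    k * sumFin f           ∎

  sumFin-*ʳ : (k : ℤ) (f : Fin n → ℤ) → sumFin (λ i → f i * k) ≡ sumFin f * k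
  sumFin-*ʳ k f = begin
    sumFin (λ i → f i * k) ≡⟨ sumFin≡sum (λ i → f i * k) ⟩
    sum (λ i → f i * k)    ≡⟨ *-distribʳ-sum k f ⟨
    sum f * k              ≡⟨ cong (_* k) (sumFin≡sum f) ⟨
    sumFin f * k           ∎

  sumFin-distrib-- : (f g : Fin n → ℤ) → sumFin (λ i → f i - g i) ≡ sumFin f - sumFin g
  sumFin-distrib-- f g = begin
    sumFin (λ i → f i - g i)
      ≡⟨ sumFin-distrib-+ f (λ i → - g i) ⟩
    sumFin f + sumFin (λ i → - g i)
      ≡⟨ cong (sumFin f +_) (sumFin-cong (λ i → -1*i≡-i (g i))) ⟨
    sumFin f + sumFin (λ i → -1ℤ * g i)
      ≡⟨ cong (sumFin f +_) (sumFin-*ˡ -1ℤ g) ⟩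
    sumFin f + -1ℤ * sumFin g
      ≡⟨ cong (sumFin f +_) (-1*i≡-i (sumFin g)) ⟩
    sumFin f - sumFin g ∎

sumFin-δˡ : ∀ {n} (y : Fin n) (f : Fin n → ℤ) → sumFin (λ x → δ x y * f x) ≡ f y
sumFin-δˡ {suc n} zero f = begin
  1ℤ * f zero + sumFin (λ x → 0ℤ * f (suc x))
    ≡⟨ cong₂ _+_ (*-identityˡ (f zero)) (sumFin-cong (λ x → *-zeroˡ (f (suc x)))) ⟩
  f zero + sumFin {n} (λ _ → 0ℤ)
    ≡⟨ cong (f zero +_) (sumFin-zero {n}) ⟩
  f zero + 0ℤ
    ≡⟨ +-identityʳ (f zero) ⟩
  f zero ∎
sumFin-δˡ {suc n} (suc y) f = trans (+-identityˡ _) (sumFin-δˡ y (λ x → f (suc x)))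

sumFin-δʳ : ∀ {n} (y : Fin n) (f : Fin n → ℤ) → sumFin (λ x → δ y x * f x) ≡ f y
sumFin-δʳ y f = trans (sumFin-cong (λ x → cong (_* f x) (δ-sym y x))) (sumFin-δˡ y f)

sumFin-comm : ∀ {m n} (F : Fin m → Fin n → ℤ) →
  sumFin (λ x → sumFin (F x)) ≡ sumFin (λ y → sumFin (λ x → F x y))
sumFin-comm F = begin
  sumFin (λ x → sumFin (F x))      ≡⟨ sumFin-cong (λ x → sumFin≡sum (F x)) ⟩
  sumFin (λ x → sum (F x))         ≡⟨ sumFin≡sum (λ x → sum (F x)) ⟩
  sum (λ x → sum (F x))            ≡⟨ ∑-comm F ⟩
  sum (λ y → sum (λ x → F x y))    ≡⟨ sumFin≡sum (λ y → sum (λ x → F x y)) ⟨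
  sumFin (λ y → sum (λ x → F x y)) ≡⟨ sumFin-cong (λ y → sumFin≡sum (λ x → F x y)) ⟨
  sumFin (λ y → sumFin (λ x → F x y)) ∎

sumTuples-cong : ∀ {q n} {f g : Tuple q n → ℤ} → (∀ c → f c ≡ g c) →
  sumTuples f ≡ sumTuples g
sumTuples-cong {zero}  f≗g = f≗g _
sumTuples-cong {suc q} f≗g = sumFin-cong (λ a → sumTuples-cong (λ c → f≗g (a ◂ c)))

sumTuples-zero : ∀ {q n} → sumTuples {q} {n} (λ _ → 0ℤ) ≡ 0ℤ
sumTuples-zero {zero}      = refl
sumTuples-zero {suc q} {n} = trans (sumFin-cong {n} (λ _ → sumTuples-zero {q} {n})) (sumFin-zero {n})

sumTuples-distrib-+ : ∀ {q n} (f g : Tuple q n → ℤ) →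
  sumTuples (λ c → f c + g c) ≡ sumTuples f + sumTuples g
sumTuples-distrib-+ {zero}  f g = refl
sumTuples-distrib-+ {suc q} {n} f g = begin
  sumFin (λ a → sumTuples (λ c → f (a ◂ c) + g (a ◂ c)))
    ≡⟨ sumFin-cong (λ a → sumTuples-distrib-+ (f ∘◂ a) (g ∘◂ a)) ⟩
  sumFin (λ a → sumTuples (f ∘◂ a) + sumTuples (g ∘◂ a))
    ≡⟨ sumFin-distrib-+ (λ a → sumTuples (f ∘◂ a)) (λ a → sumTuples (g ∘◂ a)) ⟩
  sumTuples f + sumTuples g ∎
  where
  _∘◂_ : (Tuple (suc q) n → ℤ) → Fin n → Tuple q n → ℤ
  (h ∘◂ a) c = h (a ◂ c)

sumTuples-*ˡ : ∀ {q n} (k : ℤ) (f : Tuple q n → ℤ) →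
  sumTuples (λ c → k * f c) ≡ k * sumTuples f
sumTuples-*ˡ {zero}  k f = refl
sumTuples-*ˡ {suc q} k f = trans (sumFin-cong (λ a → sumTuples-*ˡ k (λ c → f (a ◂ c))))
                                 (sumFin-*ˡ k (λ a → sumTuples (λ c → f (a ◂ c))))

sumFin-sumTuples-comm : ∀ {m q n} (F : Fin m → Tuple q n → ℤ) →
  sumFin (λ x → sumTuples (F x)) ≡ sumTuples (λ c → sumFin (λ x → F x c))
sumFin-sumTuples-comm {q = zero}  F = refl
sumFin-sumTuples-comm {q = suc q} F =
  trans (sumFin-comm (λ x a → sumTuples (λ c → F x (a ◂ c))))
        (sumFin-cong (λ a → sumFin-sumTuples-comm (λ x c → F x (a ◂ c))))

sumTuples-δ-head : ∀ {q n} (a : Fin n) (f : Tuple (suc q) n → ℤ) →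
  sumTuples (λ c → δ (c zero) a * f c) ≡ sumTuples (λ t → f (a ◂ t))
sumTuples-δ-head a f = trans (sumFin-cong (λ x → sumTuples-*ˡ (δ x a) (λ t → f (x ◂ t))))
                             (sumFin-δˡ a (λ x → sumTuples (λ t → f (x ◂ t))))

sumTuples-split-head : ∀ {q n} (f : Fin n → ℤ) (g : Tuple q n → ℤ) →
  sumTuples (λ t → f (t zero) * g (tail t)) ≡ sumFin f * sumTuples g
sumTuples-split-head f g =
  trans (sumFin-cong (λ y → sumTuples-*ˡ (f y) g)) (sumFin-*ʳ (sumTuples g) f)

pairMarginal : ∀ {q n} → (Tuple q n → ℤ) → Fin q → Fin q → Fin n → Fin n → ℤ
pairMarginal C i j a b = sumTuples (λ c → δ (c i) a * (δ (c j) b * C c))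

firstMarginal : ∀ {q n} → (Tuple (suc q) n → ℤ) → Fin n → ℤ
firstMarginal C a = sumTuples (λ t → C (a ◂ t))

restrict≡δ-weighted : ∀ {q n} (i j : Fin q) (a b : Fin n) (C : Tuple q n → ℤ) c →
  restrict i j a b C c ≡ δ (c i) a * (δ (c j) b * C c)
restrict≡δ-weighted i j a b C c with c i ≟ a | c j ≟ b
... | yes cᵢ≡a | yes cⱼ≡b = sym (begin
  δ (c i) a * (δ (c j) b * C c)
    ≡⟨ cong₂ (λ u v → u * (v * C c)) (δ-≡ cᵢ≡a) (δ-≡ cⱼ≡b) ⟩
  1ℤ * (1ℤ * C c)
    ≡⟨ trans (*-identityˡ (1ℤ * C c)) (*-identityˡ (C c)) ⟩
  C c ∎)
... | yes _ | no cⱼ≢b = sym (begin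
  δ (c i) a * (δ (c j) b * C c) ≡⟨ cong (λ v → δ (c i) a * (v * C c)) (δ-≢ cⱼ≢b) ⟩
  δ (c i) a * 0ℤ                ≡⟨ *-zeroʳ (δ (c i) a) ⟩
  0ℤ                            ∎)
... | no cᵢ≢a | _ = sym (cong (_* (δ (c j) b * C c)) (δ-≢ cᵢ≢a))

marginal≡pairMarginal : ∀ {q n} (C : Tuple q n → ℤ) (i j : Fin q) (a b : Fin n) →
  marginal C i j a b ≡ pairMarginal C i j a b
marginal≡pairMarginal C i j a b = sumTuples-cong (restrict≡δ-weighted i j a b C)

module _ {q n : ℕ} where

  pairMarginal-cong : {C D : Tuple q n → ℤ} → (∀ c → C c ≡ D c) →
    ∀ i j a b → pairMarginal C i j a b ≡ pairMarginal D i j a b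
  pairMarginal-cong C≗D i j a b =
    sumTuples-cong (λ c → cong (λ v → δ (c i) a * (δ (c j) b * v)) (C≗D c))

  pairMarginal-vanishing : {C : Tuple q n → ℤ} → (∀ c → C c ≡ 0ℤ) →
    ∀ i j a b → pairMarginal C i j a b ≡ 0ℤ
  pairMarginal-vanishing {C} C≗0 i j a b = begin
    pairMarginal C i j a b
      ≡⟨ pairMarginal-cong C≗0 i j a b ⟩
    sumTuples (λ c → δ (c i) a * (δ (c j) b * 0ℤ))
      ≡⟨ sumTuples-cong (λ c → trans (cong (δ (c i) a *_) (*-zeroʳ (δ (c j) b)))
                                     (*-zeroʳ (δ (c i) a))) ⟩
    sumTuples {q} {n} (λ _ → 0ℤ)
      ≡⟨ sumTuples-zero {q} ⟩
    0ℤ ∎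

  pairMarginal-distrib-+ : (C D : Tuple q n → ℤ) → ∀ i j a b →
    pairMarginal (λ c → C c + D c) i j a b ≡ pairMarginal C i j a b + pairMarginal D i j a b
  pairMarginal-distrib-+ C D i j a b =
    trans (sumTuples-cong distrib) (sumTuples-distrib-+ (weighted C) (weighted D))
    where
    weighted : (Tuple q n → ℤ) → Tuple q n → ℤ
    weighted E c = δ (c i) a * (δ (c j) b * E c)

    distrib : ∀ c → weighted (λ c → C c + D c) c ≡ weighted C c + weighted D c
    distrib c = trans (cong (δ (c i) a *_) (*-distribˡ-+ (δ (c j) b) (C c) (D c)))
                      (*-distribˡ-+ (δ (c i) a) (δ (c j) b * C c) (δ (c j) b * D c))

firstMarginal-distrib-+ : ∀ {q n} (C D : Tuple (suc q) n → ℤ) (a : Fin n) →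
  firstMarginal (λ c → C c + D c) a ≡ firstMarginal C a + firstMarginal D a
firstMarginal-distrib-+ C D a = sumTuples-distrib-+ (λ t → C (a ◂ t)) (λ t → D (a ◂ t))

pairMarginal-suc : ∀ {q n} (C : Tuple (suc q) n → ℤ) (i j : Fin q) (a b : Fin n) →
  pairMarginal C (suc i) (suc j) a b ≡ pairMarginal (λ t → sumFin (λ x → C (x ◂ t))) i j a b
pairMarginal-suc C i j a b = trans
  (sumFin-sumTuples-comm (λ x t → δ (t i) a * (δ (t j) b * C (x ◂ t))))
  (sumTuples-cong (λ t → trans (sumFin-*ˡ (δ (t i) a) (λ x → δ (t j) b * C (x ◂ t)))
                               (cong (δ (t i) a *_) (sumFin-*ˡ (δ (t j) b) (λ x → C (x ◂ t))))))

pairMarginal-head : ∀ {q n} (C : Tuple (suc q) n → ℤ) (j : Fin q) (a b : Fin n) →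
  pairMarginal C zero (suc j) a b ≡ sumTuples (λ t → δ (t j) b * C (a ◂ t))
pairMarginal-head C j a b = sumTuples-δ-head a (λ c → δ (c (suc j)) b * C c)

module _ {n : ℕ} where

  duplicateHead : ∀ {q} → (Tuple (suc q) n → ℤ) → Tuple (suc (suc q)) n → ℤ
  duplicateHead C c = δ (c (suc zero)) (c zero) * C (tail c)

  module _ {q : ℕ} (C : Tuple (suc q) n → ℤ) where

    duplicateHead-pairMarginal-01 : ∀ a b →
      pairMarginal (duplicateHead C) zero (suc zero) a b ≡ δ b a * firstMarginal C b
    duplicateHead-pairMarginal-01 a b = begin
      pairMarginal (duplicateHead C) zero (suc zero) a b
        ≡⟨ pairMarginal-head (duplicateHead C) zero a b ⟩
      sumTuples (λ t → δ (t zero) b * (δ (t zero) a * C t))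
        ≡⟨ sumTuples-δ-head b (λ t → δ (t zero) a * C t) ⟩
      sumTuples (λ u → δ b a * C (b ◂ u))
        ≡⟨ sumTuples-*ˡ (δ b a) (λ u → C (b ◂ u)) ⟩
      δ b a * firstMarginal C b ∎

    duplicateHead-pairMarginal-0ss : ∀ j a b →
      pairMarginal (duplicateHead C) zero (suc (suc j)) a b ≡ pairMarginal C zero (suc j) a b
    duplicateHead-pairMarginal-0ss j a b =
      trans (pairMarginal-head (duplicateHead C) (suc j) a b)
            (sumTuples-cong (λ t → x∙yz≈y∙xz (δ (t (suc j)) b) (δ (t zero) a) (C t)))

    duplicateHead-pairMarginal-ss : ∀ i j a b →
      pairMarginal (duplicateHead C) (suc i) (suc j) a b ≡ pairMarginal C i j a b
    duplicateHead-pairMarginal-ss i j a b =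
      trans (pairMarginal-suc (duplicateHead C) i j a b)
            (pairMarginal-cong (λ t → sumFin-δʳ (t zero) (λ _ → C t)) i j a b)

    duplicateHead-firstMarginal : ∀ a → firstMarginal (duplicateHead C) a ≡ firstMarginal C a
    duplicateHead-firstMarginal a = sumTuples-δ-head a C

  indicatorConst : ∀ {q} → Fin n → Tuple q n → ℤ
  indicatorConst {zero}  e c = 1ℤ
  indicatorConst {suc q} e c = δ (c zero) e * indicatorConst e (tail c)

  sumTuples-indicatorConst : ∀ {q} (e : Fin n) → sumTuples {q} (indicatorConst e) ≡ 1ℤ
  sumTuples-indicatorConst {zero}  e = refl
  sumTuples-indicatorConst {suc q} e =
    trans (sumTuples-δ-head {q} e (λ c → indicatorConst e (tail c))) (sumTuples-indicatorConst {q} e)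

  module _ (N : Matrix n) (e : Fin n) {q : ℕ} where

    embedPair : Tuple (suc (suc q)) n → ℤ
    embedPair c = N (c zero) (c (suc zero)) * indicatorConst e (tail (tail c))

    embedPair-pairMarginal-01 : ∀ a b → pairMarginal embedPair zero (suc zero) a b ≡ N a b
    embedPair-pairMarginal-01 a b = begin
      pairMarginal embedPair zero (suc zero) a b
        ≡⟨ pairMarginal-head embedPair zero a b ⟩
      sumTuples {suc q} (λ t → δ (t zero) b * (N a (t zero) * indicatorConst e (tail t)))
        ≡⟨ sumTuples-δ-head {q} b (λ t → N a (t zero) * indicatorConst e (tail t)) ⟩
      sumTuples {q} (λ u → N a b * indicatorConst e u)
        ≡⟨ sumTuples-*ˡ (N a b) (indicatorConst {q} e) ⟩
      N a b * sumTuples (indicatorConst {q} e)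
        ≡⟨ cong (N a b *_) (sumTuples-indicatorConst {q} e) ⟩
      N a b * 1ℤ
        ≡⟨ *-identityʳ (N a b) ⟩
      N a b ∎

    module _ (rows-zero : ∀ a → sumFin (N a) ≡ 0ℤ) where

      embedPair-pairMarginal-0ss : ∀ j a b → pairMarginal embedPair zero (suc (suc j)) a b ≡ 0ℤ
      embedPair-pairMarginal-0ss j a b = begin
        pairMarginal embedPair zero (suc (suc j)) a b
          ≡⟨ pairMarginal-head embedPair (suc j) a b ⟩
        sumTuples (λ t → δ (t (suc j)) b * (N a (t zero) * indicatorConst e (tail t)))
          ≡⟨ sumTuples-cong (λ t → x∙yz≈y∙xz (δ (t (suc j)) b) (N a (t zero))
                                               (indicatorConst e (tail t))) ⟩
        sumTuples (λ t → N a (t zero) * (δ (t (suc j)) b * indicatorConst e (tail t)))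
          ≡⟨ sumTuples-split-head (N a) (λ u → δ (u j) b * indicatorConst e u) ⟩
        sumFin (N a) * sumTuples (λ u → δ (u j) b * indicatorConst e u)
          ≡⟨ cong (_* sumTuples (λ u → δ (u j) b * indicatorConst e u)) (rows-zero a) ⟩
        0ℤ ∎

      embedPair-firstMarginal : ∀ a → firstMarginal embedPair a ≡ 0ℤ
      embedPair-firstMarginal a = trans (sumTuples-split-head (N a) (indicatorConst {q} e))
                                        (cong (_* sumTuples (indicatorConst {q} e)) (rows-zero a))

    embedPair-pairMarginal-ss : (∀ b → sumFin (λ a → N a b) ≡ 0ℤ) →
      ∀ i j a b → pairMarginal embedPair (suc i) (suc j) a b ≡ 0ℤ
    embedPair-pairMarginal-ss cols-zero i j a b =
      trans (pairMarginal-suc embedPair i j a b) (pairMarginal-vanishing column-vanishes i j a b)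
      where
      column-vanishes : ∀ t → sumFin (λ x → embedPair (x ◂ t)) ≡ 0ℤ
      column-vanishes t = trans (sumFin-*ʳ (indicatorConst e (tail t)) (λ x → N x (t zero)))
                                (cong (_* indicatorConst e (tail t)) (cols-zero (t zero)))

rowSum : ∀ {n} → Matrix n → Fin n → ℤ
rowSum M a = sumFin (M a)

module _ {n : ℕ} (M : Matrix n) where

  rowSumDiagonal : Matrix n
  rowSumDiagonal a b = δ b a * rowSum M b

  zeroSumPart : Matrix n
  zeroSumPart a b = M a b - rowSumDiagonal a b

  zeroSumPart-rows : ∀ a → sumFin (zeroSumPart a) ≡ 0ℤ
  zeroSumPart-rows a = begin
    sumFin (zeroSumPart a)
      ≡⟨ sumFin-distrib-- (M a) (rowSumDiagonal a) ⟩
    rowSum M a - sumFin (rowSumDiagonal a)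
      ≡⟨ cong (λ s → rowSum M a - s) (sumFin-δˡ a (rowSum M)) ⟩
    rowSum M a - rowSum M a
      ≡⟨ +-inverseʳ (rowSum M a) ⟩
    0ℤ ∎

  zeroSumPart-cols : RowColBalanced M → ∀ b → sumFin (λ a → zeroSumPart a b) ≡ 0ℤ
  zeroSumPart-cols balanced b = begin
    sumFin (λ a → zeroSumPart a b)
      ≡⟨ sumFin-distrib-- (λ a → M a b) (λ a → rowSumDiagonal a b) ⟩
    sumFin (λ a → M a b) - sumFin (λ a → rowSumDiagonal a b)
      ≡⟨ cong₂ _-_ (balanced b) (sym (sumFin-δʳ b (λ _ → rowSum M b))) ⟨
    rowSum M b - rowSum M b
      ≡⟨ +-inverseʳ (rowSum M b) ⟩
    0ℤ ∎

  module _ (e : Fin n) where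

    crystal : ∀ q → Tuple (suc q) n → ℤ
    crystal zero    c = rowSum M (c zero)
    crystal (suc q) c = duplicateHead (crystal q) c + embedPair zeroSumPart e c

    crystal-firstMarginal : ∀ q a → firstMarginal (crystal q) a ≡ rowSum M a
    crystal-firstMarginal zero    a = refl
    crystal-firstMarginal (suc q) a = begin
      firstMarginal (crystal (suc q)) a
        ≡⟨ firstMarginal-distrib-+ (duplicateHead (crystal q)) (embedPair zeroSumPart e) a ⟩
      firstMarginal (duplicateHead (crystal q)) a + firstMarginal (embedPair zeroSumPart e {q}) a
        ≡⟨ cong₂ _+_ (duplicateHead-firstMarginal (crystal q) a)
                     (embedPair-firstMarginal zeroSumPart e {q} zeroSumPart-rows a) ⟩
      firstMarginal (crystal q) a + 0ℤ
        ≡⟨ +-identityʳ (firstMarginal (crystal q) a) ⟩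
      firstMarginal (crystal q) a
        ≡⟨ crystal-firstMarginal q a ⟩
      rowSum M a ∎

    crystal-pairMarginal-split : ∀ q i j a b →
      pairMarginal (crystal (suc q)) i j a b
        ≡ pairMarginal (duplicateHead (crystal q)) i j a b
          + pairMarginal (embedPair zeroSumPart e {q}) i j a b
    crystal-pairMarginal-split q =
      pairMarginal-distrib-+ (duplicateHead (crystal q)) (embedPair zeroSumPart e)

    crystal-pairMarginal : RowColBalanced M → ∀ q (i j : Fin (suc q)) → i < j → ∀ a b →
      pairMarginal (crystal q) i j a b ≡ M a b
    crystal-pairMarginal _ zero    zero    zero    ()
    crystal-pairMarginal _ (suc q) (suc i) zero    ()
    crystal-pairMarginal _ (suc q) zero    (suc zero) _ a b = begin
      pairMarginal (crystal (suc q)) zero (suc zero) a b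
        ≡⟨ trans (crystal-pairMarginal-split q zero (suc zero) a b)
                 (cong₂ _+_ (duplicateHead-pairMarginal-01 (crystal q) a b)
                            (embedPair-pairMarginal-01 zeroSumPart e {q} a b)) ⟩
      δ b a * firstMarginal (crystal q) b + zeroSumPart a b
        ≡⟨ cong (λ r → δ b a * r + zeroSumPart a b) (crystal-firstMarginal q b) ⟩
      rowSumDiagonal a b + (M a b - rowSumDiagonal a b)
        ≡⟨ x+[y-x]≡y (rowSumDiagonal a b) (M a b) ⟩
      M a b ∎
      where
      x+[y-x]≡y : ∀ x y → x + (y - x) ≡ y
      x+[y-x]≡y = solve-∀
    crystal-pairMarginal balanced (suc q) zero (suc (suc j)) _ a b = begin
      pairMarginal (crystal (suc q)) zero (suc (suc j)) a b
        ≡⟨ trans (crystal-pairMarginal-split q zero (suc (suc j)) a b)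
                 (cong₂ _+_ (duplicateHead-pairMarginal-0ss (crystal q) j a b)
                            (embedPair-pairMarginal-0ss zeroSumPart e zeroSumPart-rows j a b)) ⟩
      pairMarginal (crystal q) zero (suc j) a b + 0ℤ
        ≡⟨ +-identityʳ (pairMarginal (crystal q) zero (suc j) a b) ⟩
      pairMarginal (crystal q) zero (suc j) a b
        ≡⟨ crystal-pairMarginal balanced q zero (suc j) (s≤s z≤n) a b ⟩
      M a b ∎
    crystal-pairMarginal balanced (suc q) (suc i) (suc j) (s≤s i<j) a b = begin
      pairMarginal (crystal (suc q)) (suc i) (suc j) a b
        ≡⟨ trans (crystal-pairMarginal-split q (suc i) (suc j) a b)
                 (cong₂ _+_ (duplicateHead-pairMarginal-ss (crystal q) i j a b)
                            (embedPair-pairMarginal-ss zeroSumPart e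
                               (zeroSumPart-cols balanced) i j a b)) ⟩
      pairMarginal (crystal q) i j a b + 0ℤ
        ≡⟨ +-identityʳ (pairMarginal (crystal q) i j a b) ⟩
      pairMarginal (crystal q) i j a b
        ≡⟨ crystal-pairMarginal balanced q i j i<j a b ⟩
      M a b ∎

theorem2p14 : (q n : ℕ) (M : Matrix n) → RowColBalanced M →
    Σ (Tuple q n → ℤ) (λ C → IsCrystal q M C)
theorem2p14 zero    n       M _        = (λ _ → 0ℤ) , λ ()
theorem2p14 (suc q) zero    M _        = (λ _ → 0ℤ) , λ _ _ _ ()
theorem2p14 (suc q) (suc n) M balanced = crystal M zero q , λ i j i<j a b →
  trans (marginal≡pairMarginal (crystal M zero q) i j a b)
        (crystal-pairMarginal M zero balanced q i j i<j a b)
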